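{- Consider a realization of a MinSet instance and a scaling factor $\gamma>0$ such that the scaled instance is scaled, i.e., every non-zero scaled coefficient $a'_i$ satisfies $a'_i\ge 1$. Let $\mathrm{OPT}$ be the optimal value of (MinSetIP) for this realization, let $Q\subseteq\mathcal{I}$, $\alpha\ge 1$ and $G\subseteq\mathcal{I}\setminus Q$. (1) If $b'_S(Q)<1$ for all $S\in\mathcal{S}$ and $g_s(Q,G)\ge\frac{1}{\alpha}\max_{I_i\in\mathcal{I}\setminus Q}g_s(Q,\{I_i\})$, then $A(Q\cup G)\le\bigl(1-\frac{1}{\alpha\cdot\mathrm{OPT}}\bigr)A(Q)$. (2) If $b'(Q)\ge 1$ and $g_c(Q,G)\ge\frac{1}{\alpha}\max_{I_i\in\mathcal{I}\setminus Q}g_c(Q,\{I_i\})$, then $b'(Q\cup G)\le\bigl(1-\frac{1}{\alpha\cdot\mathrm{OPT}}\bigr)b'(Q)$. In particular, in either case $G$ $\alpha$-approximates the greedy choice after adding $Q$.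
   Context: A MinSet instance consists of intervals $\mathcal{I}=\{I_1,\dots,I_n\}$ (each open $(L_i,U_i)$ or trivial $\{w_i\}$ with $L_i=U_i=w_i$) with values $w_i\in I_i$, and a family $\mathcal{S}$ of $m$ subsets of $\mathcal{I}$; $L_S=\sum_{I_i\in S}L_i$, $w(S)=\sum_{I_i\in S}w_i$, $w^*=\min_S w(S)$. For a fixed realization of the values, set $a_i=w_i-L_i$ and $b_S=w^*-L_S$; (MinSetIP) is the ILP $\min\sum_{I_i}x_i$ s.t. $\sum_{I_i\in S}a_ix_i\ge b_S$ for all $S\in\mathcal{S}$, $x\in\{0,1\}^{\mathcal{I}}$; $\mathrm{OPT}$ is its optimal value. For $\gamma>0$ define scaled coefficients $a'_i=\gamma a_i$, and for $Q\subseteq\mathcal{I}$: $b'_S(Q)=\max\{\gamma b_S-\sum_{I_i\in Q\cap S}a'_i,0\}$, $b'(Q)=\sum_{S\in\mathcal{S}}b'_S(Q)$, $A(Q)=|\{S\in\mathcal{S}: b'_S(Q)>0\}|$. For $G\subseteq\mathcal{I}$, the greedy values are $g_c(Q,G)=b'(Q)-b'(Q\cup G)$ and $g_s(Q,G)=A(Q)-A(Q\cup G)$. A set $G\subseteq\mathcal{I}\setminus Q$ $\alpha$-approximates the greedy choice after adding $Q$ if either $A(Q\cup G)\le(1-\frac{1}{\alpha\cdot\mathrm{OPT}})A(Q)$, or $b'(Q)\ge1$ and $b'(Q\cup G)\le(1-\frac{1}{\alpha\cdot\mathrm{OPT}})b'(Q)$.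
   Formalization: The interval endpoints $L_i$ and $U_i$, the values $w_i$, the scaling factor γ and the factor α are all rational. -}

module Defs where

open import Data.Nat using (ℕ; zero; suc)
import Data.Nat as ℕ
open import Data.Bool using (Bool; true; false; if_then_else_)
open import Data.Fin using (Fin)
import Data.Fin as Fin
open import Data.Fin.Subset using (Subset; _∈_; _∉_; _∩_; _∪_; ∣_∣)
open import Data.Vec using (lookup)
open import Data.Integer using (+_)
open import Data.Rational using (ℚ; 0ℚ; 1ℚ; _+_; _*_; _-_; _≤_; _<_; _⊔_; _⊓_; _/_)
open import Data.Rational.Properties using (_<?_)
open import Data.Product using (Σ; _×_; _,_)
open import Data.Sum using (_⊎_)
open import Relation.Binary.PropositionalEquality using (_≡_)
open import Relation.Nullary using (does)

ℕtoℚ : ℕ → ℚ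
ℕtoℚ k = + k / 1

sumF : ∀ {n} → (Fin n → ℚ) → ℚ
sumF {zero}  f = 0ℚ
sumF {suc n} f = f Fin.zero + sumF (λ i → f (Fin.suc i))

sumOver : ∀ {n} → Subset n → (Fin n → ℚ) → ℚ
sumOver X f = sumF (λ i → if lookup X i then f i else 0ℚ)

countF : ∀ {m} → (Fin m → Bool) → ℕ
countF {zero}  p = 0
countF {suc m} p = (if p Fin.zero then 1 else 0) ℕ.+ countF (λ j → p (Fin.suc j))

minF : ∀ {m} → (Fin (suc m) → ℚ) → ℚ
minF {zero}  f = f Fin.zero
minF {suc m} f = f Fin.zero ⊓ minF (λ j → f (Fin.suc j))

-- A MinSet instance with a realization: n intervals I_i = (L i, U i) or {w i},
-- values w i, and a nonempty family of m = suc k subsets of the intervals.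
record MinSet (n k : ℕ) : Set where
  field
    L U w : Fin n → ℚ
    sets  : Fin (suc k) → Subset n

ValidRealization : ∀ {n k} → MinSet n k → Set
ValidRealization M = ∀ i →
    (L i < w i × w i < U i) ⊎ (L i ≡ w i × U i ≡ w i)
  where open MinSet M

module _ {n k : ℕ} (M : MinSet n k) where
  open MinSet M

  L[_] : Fin (suc k) → ℚ
  L[ S ] = sumOver (sets S) L

  w[_] : Fin (suc k) → ℚ
  w[ S ] = sumOver (sets S) w

  wstar : ℚ
  wstar = minF w[_]

  a : Fin n → ℚ
  a i = w i - L i

  b : Fin (suc k) → ℚ
  b S = wstar - L[ S ]

  Feasible : Subset n → Set
  Feasible x = ∀ S → b S ≤ sumOver (sets S ∩ x) a

  IsOPT : ℕ → Set
  IsOPT opt = Σ (Subset n) (λ x → Feasible x × ∣ x ∣ ≡ opt)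
            × (∀ x → Feasible x → opt ℕ.≤ ∣ x ∣)

  module Scaling (γ : ℚ) where
    a′ : Fin n → ℚ
    a′ i = γ * a i

    IsScaled : Set
    IsScaled = ∀ i → (a′ i ≡ 0ℚ → Data.Empty.⊥) → 1ℚ ≤ a′ i
      where import Data.Empty

    b′S : Subset n → Fin (suc k) → ℚ
    b′S Q S = (γ * b S - sumOver (Q ∩ sets S) a′) ⊔ 0ℚ

    b′ : Subset n → ℚ
    b′ Q = sumF (b′S Q)

    A : Subset n → ℕ
    A Q = countF (λ S → does (0ℚ <? b′S Q S))

    g-c : Subset n → Subset n → ℚ
    g-c Q G = b′ Q - b′ (Q ∪ G)

    g-s : Subset n → Subset n → ℚ
    g-s Q G = ℕtoℚ (A Q) - ℕtoℚ (A (Q ∪ G))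

    -- G α-approximates the greedy choice after adding Q
    -- (inequalities X ≤ (1 - 1/(α·OPT)) Y written multiplied by α·OPT)
    AlphaApprox : ℚ → ℕ → Subset n → Subset n → Set
    AlphaApprox α opt Q G =
        (α * ℕtoℚ opt * ℕtoℚ (A (Q ∪ G)) ≤ (α * ℕtoℚ opt - 1ℚ) * ℕtoℚ (A Q))
      ⊎ (1ℚ ≤ b′ Q × (α * ℕtoℚ opt * b′ (Q ∪ G) ≤ (α * ℕtoℚ opt - 1ℚ) * b′ Q))

-- Both b′ and A are potentials Φ X = Σ_S f_S (Σ_{i ∈ X ∩ S} a′_i) with each f_S antitone:
-- f_S u = max (γ b_S − u) 0 for b′, and f_S u = [γ b_S − u > 0] for A.  On the increments
-- a′_i that occur, f_S has diminishing returns (for A this is where b′_S(Q) < 1 and the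
-- scaling a′_i ∈ {0} ∪ [1, ∞) enter), so the decrease of Φ caused by adding a set x to Q
-- is at most the sum of the decreases caused by adding its elements one at a time.
-- For x an optimal solution Φ (Q ∪ x) = 0, hence
--   Φ Q ≤ OPT · max_j (Φ Q − Φ (Q ∪ {j})) ≤ α · OPT · (Φ Q − Φ (Q ∪ G)),
-- which rearranges to the claimed bound.
module Submission where

open import Defs
open import Data.Nat using (ℕ)
open import Data.Fin using (Fin)
open import Data.Fin.Subset using (Subset; _∈_; _∉_; _∪_; ⁅_⁆)
open import Data.Rational using (ℚ; 0ℚ; 1ℚ; _*_; _-_; _≤_; _<_)
open import Data.Product using (_×_)
open import Data.Sum using (_⊎_)

open import Data.Bool using (Bool; true; false; if_then_else_)
open import Data.Bool.Properties using (∨-identityʳ)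
open import Data.Empty using (⊥-elim)
import Data.Fin as Fin
open import Data.Fin.Subset using (_∩_; _─_; ∣_∣; _⊆_; ⊥)
open import Data.Fin.Subset.Properties using (_∈?_; ∪-identityʳ; x∈p∩q⁺; x∈p∩q⁻; q⊆p∪q)
import Data.Integer as ℤ
import Data.Integer.Properties as ℤ
import Data.Nat as ℕ
import Data.Nat.Coprimality as Coprime
import Data.Nat.Properties as ℕ
open import Data.Product using (_,_)
open import Data.Rational using (_+_; -_; _⊔_; _⊓_; nonNegative; *≤*)
open import Data.Rational.Properties
  using ( ≤-refl; ≤-trans; ≤-reflexive; ≤-total; <⇒≤; <-≤-trans; _<?_
        ; +-mono-≤; +-monoʳ-≤; +-monoˡ-≤; +-identityʳ; +-identityˡ; +-inverseʳ; +-assoc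
        ; neg-distrib-+; neg-antimono-≤; *-zeroʳ; *-zeroˡ; *-distribˡ-+; *-monoˡ-≤-nonNeg
        ; p≤q⇒p⊔q≡q; p≥q⇒p⊔q≡p; p≤q⇒p⊓q≡p; p≥q⇒p⊓q≡q; ⊔-lub; ⊔-monoˡ-≤; ⊓-monoˡ-≤; p≤p⊔q
        ; normalize-coprime; _≟_; module ≤-Reasoning)
open import Data.Rational.Solver using (module +-*-Solver)
open +-*-Solver using (solve; _:+_; _:-_; _:*_; _:=_; con)
open import Data.Sum using (inj₁; inj₂)
open import Data.Vec using ([]; _∷_; lookup; here; there)
open import Data.Vec.Properties using ([]=⇒lookup; lookup⇒[]=)
open import Relation.Binary.PropositionalEquality
open import Relation.Nullary using (Dec; does; yes; no)

0≤1 : 0ℚ ≤ 1ℚ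
0≤1 = *≤* (ℤ.+≤+ ℕ.z≤n)

p≤p+q : ∀ {p q} → 0ℚ ≤ q → p ≤ p + q
p≤p+q {p} 0≤q = ≤-trans (≤-reflexive (sym (+-identityʳ p))) (+-monoʳ-≤ p 0≤q)

p≤q⇒p-q≤0 : ∀ {p q} → p ≤ q → p - q ≤ 0ℚ
p≤q⇒p-q≤0 {q = q} p≤q = ≤-trans (+-monoˡ-≤ (- q) p≤q) (≤-reflexive (+-inverseʳ q))

p≤q⇒0≤q-p : ∀ {p q} → p ≤ q → 0ℚ ≤ q - p
p≤q⇒0≤q-p {p} p≤q = ≤-trans (≤-reflexive (sym (+-inverseʳ p))) (+-monoˡ-≤ (- p) p≤q)

*-nonNeg : ∀ {p q} → 0ℚ ≤ p → 0ℚ ≤ q → 0ℚ ≤ p * q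
*-nonNeg {p} 0≤p 0≤q =
  ≤-trans (≤-reflexive (sym (*-zeroʳ p))) (*-monoˡ-≤-nonNeg p {{nonNegative 0≤p}} 0≤q)

ℕtoℚ-suc : ∀ m → ℕtoℚ (ℕ.suc m) ≡ 1ℚ + ℕtoℚ m
ℕtoℚ-suc m
  rewrite normalize-coprime {m} {0} (Coprime.sym (Coprime.1-coprimeTo m))
        | ℕ.*-identityʳ m | ℤ.+◃n≡+n m = refl

sumF-cong : ∀ {n} {f g : Fin n → ℚ} → (∀ i → f i ≡ g i) → sumF f ≡ sumF g
sumF-cong {ℕ.zero}  f≗g = refl
sumF-cong {ℕ.suc n} f≗g = cong₂ _+_ (f≗g Fin.zero) (sumF-cong (λ i → f≗g (Fin.suc i)))

sumF-zero : ∀ {n} {f : Fin n → ℚ} → (∀ i → f i ≡ 0ℚ) → sumF f ≡ 0ℚ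
sumF-zero {ℕ.zero}  f≗0 = refl
sumF-zero {ℕ.suc n} f≗0
  rewrite f≗0 Fin.zero | sumF-zero (λ i → f≗0 (Fin.suc i)) = refl

sumF-+ : ∀ {n} (f g : Fin n → ℚ) → sumF (λ i → f i + g i) ≡ sumF f + sumF g
sumF-+ {ℕ.zero}  f g = refl
sumF-+ {ℕ.suc n} f g =
  trans (cong (f Fin.zero + g Fin.zero +_) (sumF-+ (λ i → f (Fin.suc i)) (λ i → g (Fin.suc i))))
        (solve 4 (λ a b c d → (a :+ b) :+ (c :+ d) := (a :+ c) :+ (b :+ d)) refl
               (f Fin.zero) (g Fin.zero) (sumF (λ i → f (Fin.suc i))) (sumF (λ i → g (Fin.suc i))))

sumF-neg : ∀ {n} (f : Fin n → ℚ) → sumF (λ i → - f i) ≡ - sumF f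
sumF-neg {ℕ.zero}  f = refl
sumF-neg {ℕ.suc n} f =
  trans (cong (- f Fin.zero +_) (sumF-neg (λ i → f (Fin.suc i))))
        (sym (neg-distrib-+ (f Fin.zero) (sumF (λ i → f (Fin.suc i)))))

sumF-- : ∀ {n} (f g : Fin n → ℚ) → sumF (λ i → f i - g i) ≡ sumF f - sumF g
sumF-- f g = trans (sumF-+ f (λ i → - g i)) (cong (sumF f +_) (sumF-neg g))

sumF-mono : ∀ {n} {f g : Fin n → ℚ} → (∀ i → f i ≤ g i) → sumF f ≤ sumF g
sumF-mono {ℕ.zero}  f≤g = ≤-refl
sumF-mono {ℕ.suc n} f≤g = +-mono-≤ (f≤g Fin.zero) (sumF-mono (λ i → f≤g (Fin.suc i)))

sumF-comm : ∀ {n m} (f : Fin n → Fin m → ℚ) →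
  sumF (λ i → sumF (f i)) ≡ sumF (λ j → sumF (λ i → f i j))
sumF-comm {ℕ.zero} {m} f = sym (sumF-zero {m} (λ _ → refl))
sumF-comm {ℕ.suc n} f =
  trans (cong (sumF (f Fin.zero) +_) (sumF-comm (λ i → f (Fin.suc i))))
        (sym (sumF-+ (f Fin.zero) (λ j → sumF (λ i → f (Fin.suc i) j))))

countF-sumF : ∀ {m} (p : Fin m → Bool) → ℕtoℚ (countF p) ≡ sumF (λ j → if p j then 1ℚ else 0ℚ)
countF-sumF {ℕ.zero}  p = refl
countF-sumF {ℕ.suc m} p with p Fin.zero
... | true  = trans (ℕtoℚ-suc (countF (λ j → p (Fin.suc j))))
                    (cong (1ℚ +_) (countF-sumF (λ j → p (Fin.suc j))))
... | false = trans (countF-sumF (λ j → p (Fin.suc j))) (sym (+-identityˡ _))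

restrict : ∀ {n} → Subset n → (Fin n → ℚ) → Fin n → ℚ
restrict X g i = if lookup X i then g i else 0ℚ

restrict-nonNeg : ∀ {n} (X : Subset n) {g : Fin n → ℚ} → (∀ i → 0ℚ ≤ g i) → ∀ i → 0ℚ ≤ restrict X g i
restrict-nonNeg X 0≤g i with lookup X i
... | true  = 0≤g i
... | false = ≤-refl

sumOver-cong : ∀ {n} (X : Subset n) {g g′ : Fin n → ℚ} → (∀ i → g i ≡ g′ i) → sumOver X g ≡ sumOver X g′
sumOver-cong X g≗g′ = sumF-cong (λ i → cong (if lookup X i then_else 0ℚ) (g≗g′ i))

sumOver-nonNeg : ∀ {n} (X : Subset n) {g : Fin n → ℚ} → (∀ i → 0ℚ ≤ g i) → 0ℚ ≤ sumOver X g
sumOver-nonNeg {n} X 0≤g =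
  ≤-trans (≤-reflexive (sym (sumF-zero {n} (λ _ → refl)))) (sumF-mono (restrict-nonNeg X 0≤g))

sumOver-*ˡ : ∀ {n} (X : Subset n) c (g : Fin n → ℚ) → c * sumOver X g ≡ sumOver X (λ i → c * g i)
sumOver-*ˡ X c g = trans (sumF-*ˡ (restrict X g)) (sumF-cong *-restrict)
  where
  sumF-*ˡ : ∀ {n} (f : Fin n → ℚ) → c * sumF f ≡ sumF (λ i → c * f i)
  sumF-*ˡ {ℕ.zero}  f = *-zeroʳ c
  sumF-*ˡ {ℕ.suc n} f =
    trans (*-distribˡ-+ c _ _) (cong (c * f Fin.zero +_) (sumF-*ˡ (λ i → f (Fin.suc i))))
  *-restrict : ∀ i → c * restrict X g i ≡ restrict X (λ i → c * g i) i
  *-restrict i with lookup X i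
  ... | true  = refl
  ... | false = *-zeroʳ c

sumOver-mono-⊆ : ∀ {n} {X Y : Subset n} {g : Fin n → ℚ} → X ⊆ Y → (∀ i → 0ℚ ≤ g i) →
  sumOver X g ≤ sumOver Y g
sumOver-mono-⊆ {X = X} {Y} {g} X⊆Y 0≤g = sumF-mono restrict-mono
  where
  restrict-mono : ∀ i → restrict X g i ≤ restrict Y g i
  restrict-mono i with lookup X i in i∈X
  ... | true rewrite []=⇒lookup (X⊆Y (lookup⇒[]= i X i∈X)) = ≤-refl
  ... | false = restrict-nonNeg Y 0≤g i

sumOver-⊥ : ∀ {n} (g : Fin n → ℚ) → sumOver ⊥ g ≡ 0ℚ
sumOver-⊥ {ℕ.zero}  g = refl
sumOver-⊥ {ℕ.suc n} g = trans (+-identityˡ _) (sumOver-⊥ (λ i → g (Fin.suc i)))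

sumOver-⁅⁆ : ∀ {n} (j : Fin n) (g : Fin n → ℚ) → sumOver ⁅ j ⁆ g ≡ g j
sumOver-⁅⁆ Fin.zero    g = trans (cong (g Fin.zero +_) (sumOver-⊥ (λ i → g (Fin.suc i)))) (+-identityʳ _)
sumOver-⁅⁆ (Fin.suc j) g = trans (+-identityˡ _) (sumOver-⁅⁆ j (λ i → g (Fin.suc i)))

sumOver-∪-∩ : ∀ {n} (Q x s : Subset n) (h : Fin n → ℚ) →
  sumOver ((Q ∪ x) ∩ s) h ≡ sumOver (Q ∩ s) h + sumOver x (restrict (s ─ Q) h)
sumOver-∪-∩ Q x s h =
  trans (sumF-cong (restrict-∪-∩ Q x s h))
        (sumF-+ (restrict (Q ∩ s) h) (restrict x (restrict (s ─ Q) h)))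
  where
  restrict-∪-∩ : ∀ {n} (Q x s : Subset n) (h : Fin n → ℚ) i →
    restrict ((Q ∪ x) ∩ s) h i ≡ restrict (Q ∩ s) h i + restrict x (restrict (s ─ Q) h) i
  restrict-∪-∩ (q ∷ Q) (b ∷ x) (c ∷ s) h (Fin.suc i) = restrict-∪-∩ Q x s (λ i → h (Fin.suc i)) i
  restrict-∪-∩ (true  ∷ Q) (true  ∷ x) (true  ∷ s) h Fin.zero = sym (+-identityʳ _)
  restrict-∪-∩ (true  ∷ Q) (false ∷ x) (true  ∷ s) h Fin.zero = sym (+-identityʳ _)
  restrict-∪-∩ (true  ∷ Q) (true  ∷ x) (false ∷ s) h Fin.zero = refl
  restrict-∪-∩ (true  ∷ Q) (false ∷ x) (false ∷ s) h Fin.zero = refl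
  restrict-∪-∩ (false ∷ Q) (true  ∷ x) (c     ∷ s) h Fin.zero = sym (+-identityˡ _)
  restrict-∪-∩ (false ∷ Q) (false ∷ x) (c     ∷ s) h Fin.zero = refl

sumOver-comm : ∀ {n m} (x : Subset n) (g : Fin m → Fin n → ℚ) →
  sumF (λ S → sumOver x (g S)) ≡ sumOver x (λ j → sumF (λ S → g S j))
sumOver-comm {m = m} x g = trans (sumF-comm (λ S → restrict x (g S))) (sumF-cong sumF-restrict)
  where
  sumF-restrict : ∀ j → sumF (λ S → restrict x (g S) j) ≡ restrict x (λ j → sumF (λ S → g S j)) j
  sumF-restrict j with lookup x j
  ... | true  = refl
  ... | false = sumF-zero {m} (λ _ → refl)

sumOver-≤-card : ∀ {n} (x : Subset n) {g : Fin n → ℚ} {c : ℚ} → (∀ j → j ∈ x → g j ≤ c) →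
  sumOver x g ≤ ℕtoℚ ∣ x ∣ * c
sumOver-≤-card []          {c = c} g≤c = ≤-reflexive (sym (*-zeroˡ c))
sumOver-≤-card (true ∷ x)  {g} {c} g≤c = begin
  g Fin.zero + sumOver x (λ i → g (Fin.suc i))
    ≤⟨ +-mono-≤ (g≤c Fin.zero here) (sumOver-≤-card x (λ j j∈x → g≤c (Fin.suc j) (there j∈x))) ⟩
  c + ℕtoℚ ∣ x ∣ * c
    ≡⟨ solve 2 (λ m c → c :+ m :* c := (con 1ℚ :+ m) :* c) refl (ℕtoℚ ∣ x ∣) c ⟩
  (1ℚ + ℕtoℚ ∣ x ∣) * c
    ≡⟨ cong (_* c) (sym (ℕtoℚ-suc ∣ x ∣)) ⟩
  ℕtoℚ ∣ true ∷ x ∣ * c ∎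
  where open ≤-Reasoning
sumOver-≤-card (false ∷ x) g≤c =
  ≤-trans (≤-reflexive (+-identityˡ _)) (sumOver-≤-card x (λ j j∈x → g≤c (Fin.suc j) (there j∈x)))

∪-⁅⁆-absorb : ∀ {n} {j : Fin n} {Q : Subset n} → j ∈ Q → Q ∪ ⁅ j ⁆ ≡ Q
∪-⁅⁆-absorb here                     = cong (true ∷_) (∪-identityʳ _)
∪-⁅⁆-absorb {Q = b ∷ Q} (there j∈Q) = cong₂ _∷_ (∨-identityʳ b) (∪-⁅⁆-absorb j∈Q)

rearrange : ∀ α K X Y → X ≤ K * (α * (X - Y)) → α * K * Y ≤ (α * K - 1ℚ) * X
rearrange α K X Y X≤Kc = begin
  α * K * Y                         ≤⟨ p≤p+q (p≤q⇒0≤q-p X≤Kc) ⟩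
  α * K * Y + (K * (α * (X - Y)) - X)
    ≡⟨ solve 4 (λ α K X Y → α :* K :* Y :+ (K :* (α :* (X :- Y)) :- X) := (α :* K :- con 1ℚ) :* X)
             refl α K X Y ⟩
  (α * K - 1ℚ) * X                  ∎
  where open ≤-Reasoning

greedy-progress : ∀ {n} (Φ : Subset n → ℚ) (Q x G : Subset n) (α : ℚ) → 0ℚ ≤ α →
  Φ (Q ∪ G) ≤ Φ Q →
  Φ Q - Φ (Q ∪ x) ≤ sumOver x (λ j → Φ Q - Φ (Q ∪ ⁅ j ⁆)) →
  Φ (Q ∪ x) ≤ 0ℚ →
  (∀ j → j ∉ Q → Φ Q - Φ (Q ∪ ⁅ j ⁆) ≤ α * (Φ Q - Φ (Q ∪ G))) →
  α * ℕtoℚ ∣ x ∣ * Φ (Q ∪ G) ≤ (α * ℕtoℚ ∣ x ∣ - 1ℚ) * Φ Q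
greedy-progress Φ Q x G α 0≤α ΦG≤ΦQ decrease-subadditive Φx≤0 greedy =
  rearrange α (ℕtoℚ ∣ x ∣) (Φ Q) (Φ (Q ∪ G)) (begin
  Φ Q                           ≡⟨ solve 2 (λ X Z → X := (X :- Z) :+ Z) refl (Φ Q) (Φ (Q ∪ x)) ⟩
  Φ Q - Φ (Q ∪ x) + Φ (Q ∪ x)
    ≤⟨ +-mono-≤ (≤-trans decrease-subadditive (sumOver-≤-card x (λ j _ → step j))) Φx≤0 ⟩
  ℕtoℚ ∣ x ∣ * c + 0ℚ           ≡⟨ +-identityʳ _ ⟩
  ℕtoℚ ∣ x ∣ * c                ∎)
  where
  open ≤-Reasoning
  c : ℚ
  c = α * (Φ Q - Φ (Q ∪ G))
  step : ∀ j → Φ Q - Φ (Q ∪ ⁅ j ⁆) ≤ c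
  step j with j ∈? Q
  ... | yes j∈Q rewrite ∪-⁅⁆-absorb j∈Q =
    ≤-trans (≤-reflexive (+-inverseʳ (Φ Q))) (*-nonNeg 0≤α (p≤q⇒0≤q-p ΦG≤ΦQ))
  ... | no j∉Q = greedy j j∉Q

DiminishingReturns : (ℚ → Set) → (ℚ → ℚ) → ℚ → Set
DiminishingReturns P f t = ∀ {d r} → P d → 0ℚ ≤ r → f (t + d) - f (t + d + r) ≤ f t - f (t + r)

diminishing⇒decrease-subadditive : ∀ {n} {P : ℚ → Set} {f : ℚ → ℚ} {t : ℚ} →
  (∀ {d} → P d → 0ℚ ≤ d) → DiminishingReturns P f t →
  (x : Subset n) (e : Fin n → ℚ) → (∀ j → P (e j)) →
  f t - f (t + sumOver x e) ≤ sumOver x (λ j → f t - f (t + e j))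
diminishing⇒decrease-subadditive {f = f} {t} _ _ [] _ _
  rewrite +-identityʳ t = ≤-reflexive (+-inverseʳ (f t))
diminishing⇒decrease-subadditive {P = P} {f} {t} P⇒nonNeg diminishing (false ∷ x) e Pe
  rewrite +-identityˡ (sumOver x (λ i → e (Fin.suc i)))
        | +-identityˡ (sumOver x (λ i → f t - f (t + e (Fin.suc i)))) =
  diminishing⇒decrease-subadditive {P = P} {f} {t} P⇒nonNeg diminishing
    x (λ i → e (Fin.suc i)) (λ i → Pe (Fin.suc i))
diminishing⇒decrease-subadditive {P = P} {f} {t} P⇒nonNeg diminishing (true ∷ x) e Pe = begin
  f t - f (t + (d + r))                     ≡⟨ cong (λ u → f t - f u) (sym (+-assoc t d r)) ⟩
  f t - f (t + d + r)
    ≡⟨ solve 3 (λ a b c → a :- c := (a :- b) :+ (b :- c)) refl (f t) (f (t + d)) (f (t + d + r)) ⟩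
  (f t - f (t + d)) + (f (t + d) - f (t + d + r))
    ≤⟨ +-monoʳ-≤ (f t - f (t + d)) (diminishing (Pe Fin.zero) 0≤r) ⟩
  (f t - f (t + d)) + (f t - f (t + r))
    ≤⟨ +-monoʳ-≤ (f t - f (t + d))
         (diminishing⇒decrease-subadditive {P = P} {f} {t} P⇒nonNeg diminishing
            x (λ i → e (Fin.suc i)) (λ i → Pe (Fin.suc i))) ⟩
  (f t - f (t + d)) + sumOver x (λ j → f t - f (t + e (Fin.suc j))) ∎
  where
  open ≤-Reasoning
  d r : ℚ
  d = e Fin.zero
  r = sumOver x (λ i → e (Fin.suc i))
  0≤r : 0ℚ ≤ r
  0≤r = sumOver-nonNeg x (λ i → P⇒nonNeg (Pe (Fin.suc i)))

shortfall : ℚ → ℚ → ℚ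
shortfall c u = (c - u) ⊔ 0ℚ

shortfall-antitone : ∀ c {u v} → u ≤ v → shortfall c v ≤ shortfall c u
shortfall-antitone c u≤v = ⊔-monoˡ-≤ 0ℚ (+-monoʳ-≤ c (neg-antimono-≤ u≤v))

shortfall-≡0 : ∀ c u → c - u ≤ 0ℚ → shortfall c u ≡ 0ℚ
shortfall-≡0 c u = p≤q⇒p⊔q≡q

⊔0-decrease : ∀ v {r} → 0ℚ ≤ r → (v ⊔ 0ℚ) - ((v - r) ⊔ 0ℚ) ≡ (v ⊔ 0ℚ) ⊓ r
⊔0-decrease v {r} 0≤r with ≤-total v r
... | inj₁ v≤r = begin
  (v ⊔ 0ℚ) - ((v - r) ⊔ 0ℚ)   ≡⟨ cong (λ z → (v ⊔ 0ℚ) - z) (p≤q⇒p⊔q≡q (p≤q⇒p-q≤0 v≤r)) ⟩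
  (v ⊔ 0ℚ) - 0ℚ               ≡⟨ +-identityʳ (v ⊔ 0ℚ) ⟩
  v ⊔ 0ℚ                      ≡⟨ sym (p≤q⇒p⊓q≡p (⊔-lub v≤r 0≤r)) ⟩
  (v ⊔ 0ℚ) ⊓ r                ∎
  where open ≡-Reasoning
... | inj₂ r≤v = begin
  (v ⊔ 0ℚ) - ((v - r) ⊔ 0ℚ)   ≡⟨ cong₂ _-_ v⊔0≡v (p≥q⇒p⊔q≡p (p≤q⇒0≤q-p r≤v)) ⟩
  v - (v - r)                 ≡⟨ solve 2 (λ v r → v :- (v :- r) := r) refl v r ⟩
  r                           ≡⟨ sym (p≥q⇒p⊓q≡q r≤v) ⟩
  v ⊓ r                       ≡⟨ cong (_⊓ r) (sym v⊔0≡v) ⟩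
  (v ⊔ 0ℚ) ⊓ r                ∎
  where
  open ≡-Reasoning
  v⊔0≡v : v ⊔ 0ℚ ≡ v
  v⊔0≡v = p≥q⇒p⊔q≡p (≤-trans 0≤r r≤v)

shortfall-decrease : ∀ c u {r} → 0ℚ ≤ r → shortfall c u - shortfall c (u + r) ≡ shortfall c u ⊓ r
shortfall-decrease c u {r} 0≤r =
  trans (cong (λ z → shortfall c u - (z ⊔ 0ℚ))
              (solve 3 (λ c u r → c :- (u :+ r) := (c :- u) :- r) refl c u r))
        (⊔0-decrease (c - u) 0≤r)

shortfall-diminishing : ∀ c t → DiminishingReturns (0ℚ ≤_) (shortfall c) t
shortfall-diminishing c t {d} {r} 0≤d 0≤r = begin
  shortfall c (t + d) - shortfall c (t + d + r) ≡⟨ shortfall-decrease c (t + d) 0≤r ⟩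
  shortfall c (t + d) ⊓ r                       ≤⟨ ⊓-monoˡ-≤ r (shortfall-antitone c (p≤p+q 0≤d)) ⟩
  shortfall c t ⊓ r                             ≡⟨ sym (shortfall-decrease c t 0≤r) ⟩
  shortfall c t - shortfall c (t + r)           ∎
  where open ≤-Reasoning

heaviside : ℚ → ℚ
heaviside p = if does (0ℚ <? p) then 1ℚ else 0ℚ

heaviside-mono : ∀ {p q} → p ≤ q → heaviside p ≤ heaviside q
heaviside-mono {p} {q} p≤q = step (0ℚ <? p) (0ℚ <? q)
  where
  step : (0<p? : Dec (0ℚ < p)) (0<q? : Dec (0ℚ < q)) →
         (if does 0<p? then 1ℚ else 0ℚ) ≤ (if does 0<q? then 1ℚ else 0ℚ)
  step (yes _)   (yes _)   = ≤-refl
  step (yes 0<p) (no 0≮q)  = ⊥-elim (0≮q (<-≤-trans 0<p p≤q))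
  step (no _)    (yes _)   = 0≤1
  step (no _)    (no _)    = ≤-refl

ZeroOrAtLeastOne : ℚ → Set
ZeroOrAtLeastOne d = d ≡ 0ℚ ⊎ 1ℚ ≤ d

nonZero⇒ZeroOrAtLeastOne : ∀ {d} → (d ≢ 0ℚ → 1ℚ ≤ d) → ZeroOrAtLeastOne d
nonZero⇒ZeroOrAtLeastOne {d} 1≤d with d ≟ 0ℚ
... | yes d≡0 = inj₁ d≡0
... | no d≢0  = inj₂ (1≤d d≢0)

ZeroOrAtLeastOne⇒nonNeg : ∀ {d} → ZeroOrAtLeastOne d → 0ℚ ≤ d
ZeroOrAtLeastOne⇒nonNeg (inj₁ refl) = ≤-refl
ZeroOrAtLeastOne⇒nonNeg (inj₂ 1≤d)  = ≤-trans 0≤1 1≤d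

-- An increment of at least 1 exhausts a shortfall below 1, after which nothing more is lost.
heaviside-shortfall-diminishing : ∀ c t → shortfall c t < 1ℚ →
  DiminishingReturns ZeroOrAtLeastOne (λ u → heaviside (shortfall c u)) t
heaviside-shortfall-diminishing c t _ (inj₁ refl) _
  rewrite +-identityʳ t = ≤-refl
heaviside-shortfall-diminishing c t shortfall<1 {d} {r} (inj₂ 1≤d) 0≤r = begin
  heaviside (shortfall c (t + d)) - heaviside (shortfall c (t + d + r))
    ≡⟨ cong₂ (λ u v → heaviside u - heaviside v) (exhausted 1≤d)
         (trans (cong (shortfall c) (+-assoc t d r)) (exhausted (≤-trans 1≤d (p≤p+q 0≤r)))) ⟩
  heaviside 0ℚ - heaviside 0ℚ
    ≤⟨ p≤q⇒0≤q-p (heaviside-mono (shortfall-antitone c (p≤p+q 0≤r))) ⟩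
  heaviside (shortfall c t) - heaviside (shortfall c (t + r)) ∎
  where
  open ≤-Reasoning
  exhausted : ∀ {e} → 1ℚ ≤ e → shortfall c (t + e) ≡ 0ℚ
  exhausted {e} 1≤e = shortfall-≡0 c (t + e) (begin
    c - (t + e)   ≡⟨ solve 3 (λ c t e → c :- (t :+ e) := (c :- t) :- e) refl c t e ⟩
    (c - t) - e   ≤⟨ p≤q⇒p-q≤0 (≤-trans (p≤p⊔q (c - t) 0ℚ) (<⇒≤ (<-≤-trans shortfall<1 1≤e))) ⟩
    0ℚ            ∎)

module Potential {n k : ℕ} (sets : Fin (ℕ.suc k) → Subset n) (h : Fin n → ℚ) (Q : Subset n)
  (P : ℚ → Set) (P⇒nonNeg : ∀ {d} → P d → 0ℚ ≤ d) (P-0 : P 0ℚ) (P-h : ∀ i → P (h i))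
  (f : Fin (ℕ.suc k) → ℚ → ℚ) (f-antitone : ∀ S {u v} → u ≤ v → f S v ≤ f S u)
  (f-diminishing : ∀ S → DiminishingReturns P (f S) (sumOver (Q ∩ sets S) h))
  where

  Φ : Subset n → ℚ
  Φ X = sumF (λ S → f S (sumOver (X ∩ sets S) h))

  private
    t : Fin (ℕ.suc k) → ℚ
    t S = sumOver (Q ∩ sets S) h

    increment : Fin (ℕ.suc k) → Fin n → ℚ
    increment S = restrict (sets S ─ Q) h

    P-increment : ∀ S j → P (increment S j)
    P-increment S j with lookup (sets S ─ Q) j
    ... | true  = P-h j
    ... | false = P-0

    Φ-∪ : ∀ x → Φ (Q ∪ x) ≡ sumF (λ S → f S (t S + sumOver x (increment S)))
    Φ-∪ x = sumF-cong (λ S → cong (f S) (sumOver-∪-∩ Q x (sets S) h))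

    Φ-∪⁅⁆ : ∀ j → Φ (Q ∪ ⁅ j ⁆) ≡ sumF (λ S → f S (t S + increment S j))
    Φ-∪⁅⁆ j = trans (Φ-∪ ⁅ j ⁆)
      (sumF-cong (λ S → cong (λ z → f S (t S + z)) (sumOver-⁅⁆ j (increment S))))

  Φ-∪-antitone : ∀ x → Φ (Q ∪ x) ≤ Φ Q
  Φ-∪-antitone x = ≤-trans (≤-reflexive (Φ-∪ x)) (sumF-mono (λ S →
    f-antitone S (p≤p+q {t S} (sumOver-nonNeg x (λ j → P⇒nonNeg (P-increment S j))))))

  Φ-decrease-subadditive : ∀ x → Φ Q - Φ (Q ∪ x) ≤ sumOver x (λ j → Φ Q - Φ (Q ∪ ⁅ j ⁆))
  Φ-decrease-subadditive x = begin
    Φ Q - Φ (Q ∪ x)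
      ≡⟨ cong (λ z → Φ Q - z) (Φ-∪ x) ⟩
    Φ Q - sumF (λ S → f S (t S + sumOver x (increment S)))
      ≡⟨ sym (sumF-- (λ S → f S (t S)) (λ S → f S (t S + sumOver x (increment S)))) ⟩
    sumF (λ S → f S (t S) - f S (t S + sumOver x (increment S)))
      ≤⟨ sumF-mono (λ S → diminishing⇒decrease-subadditive {P = P} {f S} {t S}
                            P⇒nonNeg (f-diminishing S) x (increment S) (P-increment S)) ⟩
    sumF (λ S → sumOver x (λ j → f S (t S) - f S (t S + increment S j)))
      ≡⟨ sumOver-comm x (λ S j → f S (t S) - f S (t S + increment S j)) ⟩
    sumOver x (λ j → sumF (λ S → f S (t S) - f S (t S + increment S j)))
      ≡⟨ sumOver-cong x (λ j → trans (sumF-- (λ S → f S (t S)) (λ S → f S (t S + increment S j)))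
                                     (cong (λ z → Φ Q - z) (sym (Φ-∪⁅⁆ j)))) ⟩
    sumOver x (λ j → Φ Q - Φ (Q ∪ ⁅ j ⁆)) ∎
    where open ≤-Reasoning

module _ {n k} (M : MinSet n k) (valid : ValidRealization M) (γ : ℚ) (0≤γ : 0ℚ ≤ γ) where
  open MinSet M
  open Scaling M γ

  a′-nonNeg : ∀ i → 0ℚ ≤ a′ i
  a′-nonNeg i = *-nonNeg 0≤γ (a-nonNeg (valid i))
    where
    a-nonNeg : (L i < w i × w i < U i) ⊎ (L i ≡ w i × U i ≡ w i) → 0ℚ ≤ w i - L i
    a-nonNeg (inj₁ (L<w , _)) = p≤q⇒0≤q-p (<⇒≤ L<w)
    a-nonNeg (inj₂ (L≡w , _)) = p≤q⇒0≤q-p (≤-reflexive L≡w)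

  feasible⇒b′S≡0 : ∀ {x} → Feasible M x → ∀ Q S → b′S (Q ∪ x) S ≡ 0ℚ
  feasible⇒b′S≡0 {x} feasible Q S =
    shortfall-≡0 (γ * b M S) (sumOver ((Q ∪ x) ∩ sets S) a′) (p≤q⇒p-q≤0 (begin
    γ * b M S                        ≤⟨ *-monoˡ-≤-nonNeg γ {{nonNegative 0≤γ}} (feasible S) ⟩
    γ * sumOver (sets S ∩ x) (a M)   ≡⟨ sumOver-*ˡ (sets S ∩ x) γ (a M) ⟩
    sumOver (sets S ∩ x) a′          ≤⟨ sumOver-mono-⊆ S∩x⊆Q∪x∩S a′-nonNeg ⟩
    sumOver ((Q ∪ x) ∩ sets S) a′    ∎))
    where
    open ≤-Reasoning
    S∩x⊆Q∪x∩S : sets S ∩ x ⊆ (Q ∪ x) ∩ sets S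
    S∩x⊆Q∪x∩S i∈S∩x with x∈p∩q⁻ (sets S) x i∈S∩x
    ... | i∈S , i∈x = x∈p∩q⁺ (q⊆p∪q Q x i∈x , i∈S)

  residual-progress : ∀ {x} → Feasible M x → (Q G : Subset n) (α : ℚ) → 0ℚ ≤ α →
    (∀ i → i ∉ Q → g-c Q ⁅ i ⁆ ≤ α * g-c Q G) →
    α * ℕtoℚ ∣ x ∣ * b′ (Q ∪ G) ≤ (α * ℕtoℚ ∣ x ∣ - 1ℚ) * b′ Q
  -- b′ is Φ on the nose: b′S X S unfolds to shortfall (γ * b M S) (sumOver (X ∩ sets S) a′).
  residual-progress {x} feasible Q G α 0≤α =
    greedy-progress Φ Q x G α 0≤α (Φ-∪-antitone G) (Φ-decrease-subadditive x)
      (≤-reflexive (sumF-zero (feasible⇒b′S≡0 feasible Q)))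
    where
    open Potential sets a′ Q (0ℚ ≤_) (λ 0≤d → 0≤d) ≤-refl a′-nonNeg
      (λ S → shortfall (γ * b M S)) (λ S → shortfall-antitone (γ * b M S))
      (λ S → shortfall-diminishing (γ * b M S) _)

  unsatisfied-progress : IsScaled → ∀ {x} → Feasible M x → (Q G : Subset n) (α : ℚ) → 0ℚ ≤ α →
    (∀ S → b′S Q S < 1ℚ) →
    (∀ i → i ∉ Q → g-s Q ⁅ i ⁆ ≤ α * g-s Q G) →
    α * ℕtoℚ ∣ x ∣ * ℕtoℚ (A (Q ∪ G)) ≤ (α * ℕtoℚ ∣ x ∣ - 1ℚ) * ℕtoℚ (A Q)
  unsatisfied-progress scaled {x} feasible Q G α 0≤α b′<1 greedy =
    subst₂ (λ u v → α * ℕtoℚ ∣ x ∣ * u ≤ (α * ℕtoℚ ∣ x ∣ - 1ℚ) * v) (sym (A≡Φ (Q ∪ G))) (sym (A≡Φ Q))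
      (greedy-progress Φ Q x G α 0≤α (Φ-∪-antitone G) (Φ-decrease-subadditive x)
        (≤-reflexive (sumF-zero (λ S → cong heaviside (feasible⇒b′S≡0 feasible Q S)))) greedy′)
    where
    open Potential sets a′ Q ZeroOrAtLeastOne ZeroOrAtLeastOne⇒nonNeg (inj₁ refl)
      (λ i → nonZero⇒ZeroOrAtLeastOne (scaled i))
      (λ S u → heaviside (shortfall (γ * b M S) u))
      (λ S u≤v → heaviside-mono (shortfall-antitone (γ * b M S) u≤v))
      (λ S → heaviside-shortfall-diminishing (γ * b M S) _ (b′<1 S))

    A≡Φ : ∀ X → ℕtoℚ (A X) ≡ Φ X
    A≡Φ X = countF-sumF (λ S → does (0ℚ <? b′S X S))

    greedy′ : ∀ i → i ∉ Q → Φ Q - Φ (Q ∪ ⁅ i ⁆) ≤ α * (Φ Q - Φ (Q ∪ G))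
    greedy′ i i∉Q = subst₂ (λ u v → u ≤ α * v)
      (cong₂ _-_ (A≡Φ Q) (A≡Φ (Q ∪ ⁅ i ⁆))) (cong₂ _-_ (A≡Φ Q) (A≡Φ (Q ∪ G))) (greedy i i∉Q)

lemma1 : ∀ {n k} (M : MinSet n k) → ValidRealization M →
    (γ : ℚ) → 0ℚ < γ → Scaling.IsScaled M γ →
    (opt : ℕ) → IsOPT M opt →
    (Q G : Subset n) → (α : ℚ) → 1ℚ ≤ α →
    (∀ i → i ∈ G → i ∉ Q) →
    let open Scaling M γ in
    ((∀ S → b′S Q S < 1ℚ) →
       (∀ i → i ∉ Q → g-s Q ⁅ i ⁆ ≤ α * g-s Q G) →
       α * ℕtoℚ opt * ℕtoℚ (A (Q ∪ G)) ≤ (α * ℕtoℚ opt - 1ℚ) * ℕtoℚ (A Q))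
    × ((1ℚ ≤ b′ Q) →
       (∀ i → i ∉ Q → g-c Q ⁅ i ⁆ ≤ α * g-c Q G) →
       α * ℕtoℚ opt * b′ (Q ∪ G) ≤ (α * ℕtoℚ opt - 1ℚ) * b′ Q)
    × ((((∀ S → b′S Q S < 1ℚ) × (∀ i → i ∉ Q → g-s Q ⁅ i ⁆ ≤ α * g-s Q G))
       ⊎ ((1ℚ ≤ b′ Q) × (∀ i → i ∉ Q → g-c Q ⁅ i ⁆ ≤ α * g-c Q G))) →
       AlphaApprox α opt Q G)
lemma1 M valid γ 0<γ scaled _ ((x , feasible , refl) , _) Q G α 1≤α _ =
    unsatisfied-progress M valid γ 0≤γ scaled feasible Q G α 0≤α
  , (λ _ → residual-progress M valid γ 0≤γ feasible Q G α 0≤α)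
  , λ { (inj₁ (b′<1 , greedy)) →
          inj₁ (unsatisfied-progress M valid γ 0≤γ scaled feasible Q G α 0≤α b′<1 greedy)
      ; (inj₂ (1≤b′ , greedy)) →
          inj₂ (1≤b′ , residual-progress M valid γ 0≤γ feasible Q G α 0≤α greedy) }
  where
  0≤γ : 0ℚ ≤ γ
  0≤γ = <⇒≤ 0<γ
  0≤α : 0ℚ ≤ α
  0≤α = ≤-trans 0≤1 1≤α
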